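{- Let $\Delta\geq 4$ be an integer. If $G$ is a $\rho$-$\Delta$-critical graph, then $G$ contains no vertex $u$ with $\deg_G(u)=2$, $N_G(u)=\{v,w\}$ and $\deg_G(v)=\deg_G(w)=\Delta-1$.
   Context: All graphs are simple. For a graph $G$, an incidence is a pair $(v,e)$ with $v$ an endpoint of the edge $e$; $I(G)$ is the set of incidences. For $u\in V(G)$ and a neighbor $v$, $(u,uv)$ is a strong incidence of $u$ and $(v,uv)$ is a weak incidence of $u$; $I_u$, $A_u$ denote the sets of strong, resp. weak, incidences of $u$. Let $[\Delta]=\{1,\dots,\Delta\}$. A conditional incidence $\Delta$-coloring of $G$ is a map $\varphi: I(G)\to[\Delta]$ such that: (a) $(u,uv)$ and $(v,uv)$ receive distinct colors for each edge $uv$; (b) each color appears at most once among $A_u$ for each vertex $u$; (c) each color appears at most once among $I_u$ for each vertex $u$; (d) each color of $[\Delta]$ appears at least once among $A_u\cup I_u$ for each vertex $u$ with $\deg_G(u)\geq\Delta-1$. A graph $G$ is $\rho$-$\Delta$-critical if $\Delta(G)\leq\Delta$, $G$ has no conditional incidence $\Delta$-coloring, but every proper subgraph of $G$ has one. -}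

module Defs where

open import Data.Nat using (ℕ; _≤_; _∸_)
open import Data.Bool using (Bool; true; false; if_then_else_)
open import Data.Fin using (Fin)
open import Data.List using (List; map; allFin)
open import Data.Nat.ListAction using (sum)
open import Data.Product using (Σ; ∃; ∃-syntax; _×_)
open import Data.Sum using (_⊎_)
open import Relation.Binary.PropositionalEquality using (_≡_; _≢_)
open import Relation.Nullary using (¬_)

-- A finite simple graph whose vertex set is a subset of Fin n.
-- V u = true  : u is a vertex;  E u v = true : uv is an edge.
record Graph (n : ℕ) : Set where
  field
    V      : Fin n → Bool
    E      : Fin n → Fin n → Bool
    sym    : ∀ u v → E u v ≡ E v u
    irrefl : ∀ u → E u u ≡ false
    edgeV  : ∀ u v → E u v ≡ true → V u ≡ true
open Graph public

Adj : ∀ {n} → Graph n → Fin n → Fin n → Set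
Adj G u v = E G u v ≡ true

deg : ∀ {n} → Graph n → Fin n → ℕ
deg {n} G u = sum (map (λ v → if E G u v then 1 else 0) (allFin n))

MaxDegLe : ∀ {n} → Graph n → ℕ → Set
MaxDegLe G Δ = ∀ u → deg G u ≤ Δ

Subgraph : ∀ {n} → Graph n → Graph n → Set
Subgraph H G = (∀ u → V H u ≡ true → V G u ≡ true)
             × (∀ u v → E H u v ≡ true → E G u v ≡ true)

ProperSubgraph : ∀ {n} → Graph n → Graph n → Set
ProperSubgraph H G = Subgraph H G
  × ((∃[ u ] (V G u ≡ true × V H u ≡ false))
     ⊎ (∃[ u ] ∃[ v ] (E G u v ≡ true × E H u v ≡ false)))

-- An incidence colouring φ : φ u v is the colour of the incidence (u, uv)
-- (only meaningful when uv is an edge). Colours [Δ] are Fin Δ.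
IsCondIncColoring : ∀ {n} → (Δ : ℕ) → Graph n → (Fin n → Fin n → Fin Δ) → Set
IsCondIncColoring {n} Δ G φ =
    (∀ u v → Adj G u v → φ u v ≢ φ v u)
    -- (b) weak incidences (v,uv) of u have distinct colours
  × (∀ u v w → Adj G u v → Adj G u w → φ v u ≡ φ w u → v ≡ w)
    -- (c) strong incidences (u,uv) of u have distinct colours
  × (∀ u v w → Adj G u v → Adj G u w → φ u v ≡ φ u w → v ≡ w)
  × (∀ u → V G u ≡ true → Δ ∸ 1 ≤ deg G u →
       ∀ (c : Fin Δ) → ∃[ v ] (Adj G u v × (φ u v ≡ c ⊎ φ v u ≡ c)))

HasCondIncColoring : ∀ {n} → ℕ → Graph n → Set
HasCondIncColoring Δ G = Σ (_ → _ → Fin Δ) (IsCondIncColoring Δ G)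

RhoCritical : ∀ {n} → ℕ → Graph n → Set
RhoCritical Δ G = MaxDegLe G Δ
  × ¬ HasCondIncColoring Δ G
  × (∀ H → ProperSubgraph H G → HasCondIncColoring Δ H)

{-# OPTIONS --safe #-}

-- By minimality G − u has a conditional incidence Δ-colouring φ. In G − u the neighbours v
-- and w of u have degree Δ − 2, so at each of them exactly two colours S are missing from
-- its strong incidences and two colours W from its weak incidences. Colouring (v , vu) by
-- some a ∈ S and (u , vu) by some b ∈ W with a ≠ b preserves (a)–(c) at v, and (d) at v as
-- long as {a , b} covers S ∩ W; likewise a′, b′ at w. A case analysis on how S meets W shows
-- that this can be done with a ≠ a′ and b ≠ b′, which is all that (b) and (c) ask at u,
-- while (d) is void at u because 2 < Δ − 1. So φ extends to G, a contradiction.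

module Submission where

open import Defs hiding (sym)
open import Data.Bool using (Bool; true; false; if_then_else_; not; _∧_)
open import Data.Bool.Properties using () renaming (_≟_ to _≟ᵇ_)
open import Data.Empty using (⊥-elim)
open import Data.Fin using (Fin)
open import Data.Fin.Properties using (_≟_)
open import Data.List using (List; []; _∷_; length; map; filter; allFin; _++_)
open import Data.List.Membership.Propositional using (_∈_; _∉_)
open import Data.List.Membership.Propositional.Properties
  using (∈-filter⁺; ∈-filter⁻; ∈-allFin; ∈-map⁺; ∈-map⁻; ∈-++⁺ˡ; ∈-++⁺ʳ)
open import Data.List.Membership.Propositional.Properties.WithK using (unique∧set⇒bag)
open import Data.List.Properties using (length-map; length-++; length-tabulate)
open import Data.List.Relation.Binary.BagAndSetEquality using (∼bag⇒↭)
open import Data.List.Relation.Binary.Permutation.Propositional.Properties using (↭-length)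
open import Data.List.Relation.Unary.All as All using ([]; _∷_)
import Data.List.Relation.Unary.All.Properties as All
open import Data.List.Relation.Unary.AllPairs using ([]; _∷_)
open import Data.List.Relation.Unary.Any using (here; there; any?)
open import Data.List.Relation.Unary.Unique.Propositional using (Unique)
open import Data.List.Relation.Unary.Unique.Propositional.Properties using (filter⁺; allFin⁺; ++⁺)
open import Data.Nat using (ℕ; suc; _+_; _≤_; _<_; _∸_; s≤s; z≤n)
open import Data.Nat.ListAction using (sum)
open import Data.Nat.Properties using (+-comm; +-cancelˡ-≡; <⇒≱)
open import Data.Product using (∃₂; ∃-syntax; _×_; _,_; proj₁; proj₂)
open import Data.Sum using (_⊎_; inj₁; inj₂)
import Data.Sum as Sum
open import Function using (_∘_)
open import Function.Bundles using (_⇔_; mk⇔; Equivalence)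
open Equivalence using (to; from)
open import Relation.Binary.Definitions using (DecidableEquality)
open import Relation.Binary.PropositionalEquality
  using (_≡_; _≢_; refl; sym; trans; cong; subst; subst₂; module ≡-Reasoning)
open import Relation.Nullary using (¬_; Dec; yes; no; does; ¬?)
open import Relation.Nullary.Decidable using (dec-true; dec-false; toSum; _⊎-dec_)

infix 4 _∈₂_

_∈₂_ : {A : Set} → A → A × A → Set
c ∈₂ (p , q) = c ≡ p ⊎ c ≡ q

Distinct : {A : Set} → A × A → Set
Distinct (p , q) = p ≢ q

module Admissibility {A : Set} (_≟_ : DecidableEquality A) where

  -- S and W are the strong and weak colours missing at a vertex x of G − u,
  -- a and b the colours of the new incidences (x , xu) and (u , xu).
  Admissible : (S W : A × A) (a b : A) → Set
  Admissible S W a b =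
    a ∈₂ S × b ∈₂ W × a ≢ b × (∀ {c} → c ∈₂ S → c ∈₂ W → c ∈₂ (a , b))

  Avoids : (S W : A × A) (x y : A) → Set
  Avoids S W x y = ∃₂ λ a b → Admissible S W a b × a ≢ x × b ≢ y

  Flexible : (S W : A × A) → Set
  Flexible S W = ∀ {x y} → x ≢ y → Avoids S W x y

  FlexibleExcept : (S W : A × A) → A × A → Set
  FlexibleExcept S W (x₀ , y₀) = ∀ {x y} → x ≢ y → x ≢ x₀ ⊎ y ≢ y₀ → Avoids S W x y

  Crossing : (S W : A × A) → Set
  Crossing S W = ∃[ m ] ∃[ p ] ∃[ q ] Admissible S W m p × Admissible S W q m

  TwoChoices : (S W : A × A) → Set
  TwoChoices S W = ∃₂ λ a₁ b₁ → ∃₂ λ a₂ b₂ →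
    Admissible S W a₁ b₁ × Admissible S W a₂ b₂ × a₁ ≢ a₂

  ∈₂-avoiding : ∀ {S} → Distinct S → ∀ x → ∃[ a ] a ∈₂ S × a ≢ x
  ∈₂-avoiding {p , q} p≢q x with x ≟ p
  ... | yes refl = q , inj₂ refl , p≢q ∘ sym
  ... | no x≢p   = p , inj₁ refl , x≢p ∘ sym

  ∈₂-cover : ∀ {S : A × A} {p q c} → p ∈₂ S → q ∈₂ S → p ≢ q → c ∈₂ S → c ∈₂ (p , q)
  ∈₂-cover (inj₁ refl) (inj₁ refl) p≢q _ = ⊥-elim (p≢q refl)
  ∈₂-cover (inj₂ refl) (inj₂ refl) p≢q _ = ⊥-elim (p≢q refl)
  ∈₂-cover (inj₁ refl) (inj₂ refl) _ c∈S = c∈S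
  ∈₂-cover (inj₂ refl) (inj₁ refl) _ c∈S = Sum.swap c∈S

  -- If S = {c , s} and W = {c , t}, the admissible pairs are (c , t) and (s , c).
  shared⇒crossing : ∀ {S W c} → Distinct S → Distinct W → c ∈₂ S → c ∈₂ W → Crossing S W
  shared⇒crossing {c = c} S! W! c∈S c∈W with ∈₂-avoiding S! c | ∈₂-avoiding W! c
  ... | s , s∈S , s≢c | t , t∈W , t≢c =
    c , t , s ,
    (c∈S , t∈W , t≢c ∘ sym , λ _ d∈W → ∈₂-cover c∈W t∈W (t≢c ∘ sym) d∈W) ,
    (s∈S , c∈W , s≢c , λ d∈S _ → ∈₂-cover s∈S c∈S s≢c d∈S)

  disjoint⇒flexible : ∀ {S W} → Distinct S → Distinct W → (∀ {c} → c ∈₂ S → ¬ c ∈₂ W) → Flexible S W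
  disjoint⇒flexible S! W! disjoint {x} {y} _ with ∈₂-avoiding S! x | ∈₂-avoiding W! y
  ... | a , a∈S , a≢x | b , b∈W , b≢y =
    a , b , (a∈S , b∈W , (λ { refl → disjoint a∈S b∈W }) , λ c∈S c∈W → ⊥-elim (disjoint c∈S c∈W)) ,
    a≢x , b≢y

  flexible-or-crossing : ∀ {S W} → Distinct S → Distinct W → Flexible S W ⊎ Crossing S W
  flexible-or-crossing {s₁ , s₂} {w₁ , w₂} S! W!
    with (s₁ ≟ w₁ ⊎-dec s₁ ≟ w₂) | (s₂ ≟ w₁ ⊎-dec s₂ ≟ w₂)
  ... | yes s₁∈W | _        = inj₂ (shared⇒crossing S! W! (inj₁ refl) s₁∈W)
  ... | no _     | yes s₂∈W = inj₂ (shared⇒crossing S! W! (inj₂ refl) s₂∈W)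
  ... | no s₁∉W  | no s₂∉W  =
    inj₁ (disjoint⇒flexible S! W! λ { (inj₁ refl) → s₁∉W ; (inj₂ refl) → s₂∉W })

  crossing⇒flexibleExcept : ∀ {S W} → ((m , p , q , _) : Crossing S W) → FlexibleExcept S W (q , p)
  crossing⇒flexibleExcept (m , p , q , mp@(_ , _ , m≢p , _) , qm@(_ , _ , q≢m , _))
    {x} {y} x≢y x≢q⊎y≢p with x ≟ m | y ≟ p
  ... | yes refl | _        = q , m , qm , q≢m , x≢y
  ... | no x≢m   | no y≢p   = m , p , mp , x≢m ∘ sym , y≢p ∘ sym
  ... | no _     | yes refl with x≢q⊎y≢p
  ...   | inj₁ x≢q = q , m , qm , x≢q ∘ sym , m≢p
  ...   | inj₂ p≢p = ⊥-elim (p≢p refl)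

  flexibleExcept : ∀ {S W} → Distinct S → Distinct W → ∃[ e ] FlexibleExcept S W e
  flexibleExcept {S} S! W! with flexible-or-crossing S! W!
  ... | inj₁ flex               = S , λ x≢y _ → flex x≢y
  ... | inj₂ cr@(_ , p , q , _) = (q , p) , crossing⇒flexibleExcept cr

  twoChoices : ∀ {S W} → Distinct S → Distinct W → TwoChoices S W
  twoChoices {_ , _} S! W! with flexible-or-crossing S! W!
  ... | inj₂ (m , p , q , mp , qm@(_ , _ , q≢m , _)) = m , p , q , m , mp , qm , q≢m ∘ sym
  ... | inj₁ flex with flex S!
  ...   | a₁ , b₁ , ab₁@(_ , _ , a₁≢b₁ , _) , _ with flex a₁≢b₁
  ...     | a₂ , b₂ , ab₂ , a₂≢a₁ , _ = a₁ , b₁ , a₂ , b₂ , ab₁ , ab₂ , a₂≢a₁ ∘ sym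

  Compatible : (S W S′ W′ : A × A) → Set
  Compatible S W S′ W′ = ∃₂ λ a b → ∃₂ λ a′ b′ →
    Admissible S W a b × Admissible S′ W′ a′ b′ × a ≢ a′ × b ≢ b′

  flexibleExcept-compatible : ∀ {S W S′ W′ x₀ y₀ a′ b′} → FlexibleExcept S W (x₀ , y₀) →
    Admissible S′ W′ a′ b′ → a′ ≢ x₀ → Compatible S W S′ W′
  flexibleExcept-compatible flexExc ab′@(_ , _ , a′≢b′ , _) a′≢x₀
    with flexExc a′≢b′ (inj₁ a′≢x₀)
  ... | a , b , ab , a≢a′ , b≢b′ = a , b , _ , _ , ab , ab′ , a≢a′ , b≢b′

  -- Of two admissible choices for (S′ , W′) with different first colours,
  -- one avoids the exceptional point of (S , W).
  compatible : ∀ {S W S′ W′} → Distinct S → Distinct W → Distinct S′ → Distinct W′ →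
    Compatible S W S′ W′
  compatible S! W! S′! W′! with flexibleExcept S! W! | twoChoices S′! W′!
  ... | (x₀ , _) , flexExc | a₁ , _ , _ , _ , ab₁ , ab₂ , a₁≢a₂ with a₁ ≟ x₀
  ...   | yes refl  = flexibleExcept-compatible flexExc ab₂ (a₁≢a₂ ∘ sym)
  ...   | no a₁≢x₀ = flexibleExcept-compatible flexExc ab₁ a₁≢x₀

InjectiveOn : {A B : Set} → (A → Set) → (A → B) → Set
InjectiveOn P f = ∀ {y z} → P y → P z → f y ≡ f z → y ≡ z

injectiveOn-cong : {A B : Set} {P : A → Set} {f g : A → B} →
  (∀ {y} → P y → f y ≡ g y) → InjectiveOn P f → InjectiveOn P g
injectiveOn-cong f≗g f-inj Py Pz gy≡gz = f-inj Py Pz (trans (f≗g Py) (trans gy≡gz (sym (f≗g Pz))))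

injectiveOn-insert : {A B : Set} {P : A → Set} {f : A → B} (_≟ᴬ_ : DecidableEquality A) (u : A) →
  InjectiveOn (λ y → P y × y ≢ u) f → (P u → ∀ {y} → P y → y ≢ u → f u ≢ f y) → InjectiveOn P f
injectiveOn-insert _≟ᴬ_ u f-inj fu-fresh {y} {z} Py Pz fy≡fz with y ≟ᴬ u | z ≟ᴬ u
... | yes refl | yes refl = refl
... | yes refl | no z≢u   = ⊥-elim (fu-fresh Py Pz z≢u fy≡fz)
... | no y≢u   | yes refl = ⊥-elim (fu-fresh Pz Py y≢u (sym fy≡fz))
... | no y≢u   | no z≢u   = f-inj (Py , y≢u) (Pz , z≢u) fy≡fz

record MissingPair {A C : Set} (P : A → Set) (f : A → C) (S : C × C) : Set where
  field
    distinct      : Distinct S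
    missed        : ∀ {c} → c ∈₂ S → ∀ {y} → P y → f y ≢ c
    hit-or-missed : ∀ c → (∃[ y ] P y × f y ≡ c) ⊎ c ∈₂ S

module _ {A : Set} where

  unique-⇔-length : {xs ys : List A} → Unique xs → Unique ys →
    (∀ {z} → z ∈ xs ⇔ z ∈ ys) → length xs ≡ length ys
  unique-⇔-length xs! ys! xs⇔ys = ↭-length (∼bag⇒↭ (unique∧set⇒bag xs! ys! xs⇔ys))

  pair-of-length-2 : {xs : List A} → Unique xs → length xs ≡ 2 →
    ∃[ S ] Distinct S × (∀ {c} → c ∈ xs ⇔ c ∈₂ S)
  pair-of-length-2 {a ∷ b ∷ []} ((a≢b ∷ []) ∷ _) refl = (a , b) , a≢b , mk⇔
    (λ { (here c≡a) → inj₁ c≡a ; (there (here c≡b)) → inj₂ c≡b })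
    (λ { (inj₁ c≡a) → here c≡a ; (inj₂ c≡b) → there (here c≡b) })

  map-unique : {B : Set} {f : A → B} {xs : List A} →
    InjectiveOn (_∈ xs) f → Unique xs → Unique (map f xs)
  map-unique _     []           = []
  map-unique f-inj (x∉xs ∷ xs!) =
    All.map⁺ (All.tabulate λ y∈xs fx≡fy →
      All.lookup x∉xs y∈xs (f-inj (here refl) (there y∈xs) fx≡fy))
    ∷ map-unique (λ y∈ z∈ → f-inj (there y∈) (there z∈)) xs!

module _ {D : ℕ} where

  _∉?_ : (c : Fin D) (I : List (Fin D)) → Dec (c ∉ I)
  c ∉? I = ¬? (any? (c ≟_) I)

  missing : List (Fin D) → List (Fin D)
  missing I = filter (_∉? I) (allFin D)

  length-++-missing : {I : List (Fin D)} → Unique I → length I + length (missing I) ≡ D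
  length-++-missing {I} I! = begin
    length I + length (missing I) ≡⟨ length-++ I ⟨
    length (I ++ missing I)       ≡⟨ unique-⇔-length I++missing-unique (allFin⁺ D) everything ⟩
    length (allFin D)             ≡⟨ length-tabulate (λ c → c) ⟩
    D                             ∎
    where
    open ≡-Reasoning
    I++missing-unique : Unique (I ++ missing I)
    I++missing-unique = ++⁺ I! (filter⁺ _ (allFin⁺ D))
      λ (c∈I , c∈C) → proj₂ (∈-filter⁻ (_∉? I) {xs = allFin D} c∈C) c∈I
    everything : ∀ {c} → c ∈ I ++ missing I ⇔ c ∈ allFin D
    everything {c} = mk⇔ (λ _ → ∈-allFin c) λ _ → ∈-I-or-missing
      where
      ∈-I-or-missing : c ∈ I ++ missing I
      ∈-I-or-missing with any? (c ≟_) I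
      ... | yes c∈I = ∈-++⁺ˡ c∈I
      ... | no c∉I  = ∈-++⁺ʳ I (∈-filter⁺ _ (∈-allFin c) c∉I)

missingPair : {A : Set} {P : A → Set} {D : ℕ} (L : List A) → Unique L → (∀ {y} → y ∈ L ⇔ P y) →
  (f : A → Fin D) → InjectiveOn P f → length L + 2 ≡ D → ∃[ S ] MissingPair P f S
missingPair {P = P} L L! L⇔P f f-inj len =
  fromPair (pair-of-length-2 (filter⁺ _ (allFin⁺ _)) length-missing)
  where
  I = map f L
  I-unique : Unique I
  I-unique = map-unique (λ y∈ z∈ → f-inj (to L⇔P y∈) (to L⇔P z∈)) L!
  length-missing : length (missing I) ≡ 2
  length-missing = +-cancelˡ-≡ (length L) _ _ (begin
    length L + length (missing I) ≡⟨ cong (_+ length (missing I)) (length-map f L) ⟨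
    length I + length (missing I) ≡⟨ length-++-missing I-unique ⟩
    _                             ≡⟨ len ⟨
    length L + 2                  ∎)
    where open ≡-Reasoning
  fromPair : ∃[ S ] Distinct S × (∀ {c} → c ∈ missing I ⇔ c ∈₂ S) → ∃[ S ] MissingPair P f S
  fromPair (S , S! , C⇔S) = S , record
    { distinct      = S!
    ; missed        = missed
    ; hit-or-missed = hit-or-missed
    }
    where
    missed : ∀ {c} → c ∈₂ S → ∀ {y} → P y → f y ≢ c
    missed c∈S Py refl =
      proj₂ (∈-filter⁻ (_∉? I) {xs = allFin _} (from C⇔S c∈S)) (∈-map⁺ f (from L⇔P Py))
    hit-or-missed : ∀ c → (∃[ y ] P y × f y ≡ c) ⊎ c ∈₂ S
    hit-or-missed c with any? (c ≟_) I
    ... | yes c∈I = let (y , y∈L , c≡fy) = ∈-map⁻ f c∈I in inj₁ (y , to L⇔P y∈L , sym c≡fy)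
    ... | no c∉I  = inj₂ (to C⇔S (∈-filter⁺ _ (∈-allFin c) c∉I))

length-filter≡sum : {A : Set} (b : A → Bool) (xs : List A) →
  length (filter (λ y → b y ≟ᵇ true) xs) ≡ sum (map (λ y → if b y then 1 else 0) xs)
length-filter≡sum b [] = refl
length-filter≡sum b (x ∷ xs) with b x
... | true  = cong suc (length-filter≡sum b xs)
... | false = length-filter≡sum b xs

module _ {n : ℕ} (G : Graph n) where

  adj-sym : ∀ {x y} → Adj G x y → Adj G y x
  adj-sym {x} {y} xy = trans (Graph.sym G y x) xy

  adj-≢ : ∀ {x y} → Adj G x y → x ≢ y
  adj-≢ {x} xx refl with trans (sym xx) (irrefl G x)
  ... | ()

nbrs : ∀ {n} → Graph n → Fin n → List (Fin n)
nbrs {n} G x = filter (λ y → E G x y ≟ᵇ true) (allFin n)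

∈-nbrs : ∀ {n} (G : Graph n) x {y} → y ∈ nbrs G x ⇔ Adj G x y
∈-nbrs {n} G x = mk⇔ (proj₂ ∘ ∈-filter⁻ _ {xs = allFin n}) (∈-filter⁺ _ (∈-allFin _))

nbrs-unique : ∀ {n} (G : Graph n) x → Unique (nbrs G x)
nbrs-unique {n} G x = filter⁺ _ (allFin⁺ n)

length-nbrs : ∀ {n} (G : Graph n) x → length (nbrs G x) ≡ deg G x
length-nbrs {n} G x = length-filter≡sum (E G x) (allFin n)

infixl 6 _∖_
_∖_ : ∀ {n} → Graph n → Fin n → Graph n
_∖_ {n} G u = record
  { V      = λ x → kept x ∧ V G x
  ; E      = E∖
  ; sym    = E∖-sym
  ; irrefl = E∖-irrefl
  ; edgeV  = E∖-vertex
  }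
  where
  kept : Fin n → Bool
  kept x = not (does (x ≟ u))

  E∖ : Fin n → Fin n → Bool
  E∖ x y = kept x ∧ kept y ∧ E G x y

  E∖-sym : ∀ x y → E∖ x y ≡ E∖ y x
  E∖-sym x y with x ≟ u | y ≟ u
  ... | yes _ | yes _ = refl
  ... | yes _ | no _  = refl
  ... | no _  | yes _ = refl
  ... | no _  | no _  = Graph.sym G x y

  E∖-irrefl : ∀ x → E∖ x x ≡ false
  E∖-irrefl x with x ≟ u
  ... | yes _ = refl
  ... | no _  = irrefl G x

  E∖-vertex : ∀ x y → E∖ x y ≡ true → kept x ∧ V G x ≡ true
  E∖-vertex x y xy with x ≟ u | y ≟ u
  ... | no _ | no _ = edgeV G x y xy

module VertexDeletion {n : ℕ} (G : Graph n) (u : Fin n) where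

  ∖-adj⁻ : ∀ {x y} → Adj (G ∖ u) x y → Adj G x y × x ≢ u × y ≢ u
  ∖-adj⁻ {x} {y} xy with x ≟ u | y ≟ u
  ... | no x≢u | no y≢u = xy , x≢u , y≢u

  ∖-adj⁺ : ∀ {x y} → Adj G x y → x ≢ u → y ≢ u → Adj (G ∖ u) x y
  ∖-adj⁺ {x} {y} xy x≢u y≢u rewrite dec-false (x ≟ u) x≢u | dec-false (y ≟ u) y≢u = xy

  ∖-vertex⁺ : ∀ {x} → x ≢ u → V G x ≡ true → V (G ∖ u) x ≡ true
  ∖-vertex⁺ {x} x≢u Vx rewrite dec-false (x ≟ u) x≢u = Vx

  ∖-proper : V G u ≡ true → ProperSubgraph (G ∖ u) G
  ∖-proper Vu = (vertex⁻ , λ _ _ → proj₁ ∘ ∖-adj⁻) , inj₁ (u , Vu , removed)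
    where
    vertex⁻ : ∀ x → V (G ∖ u) x ≡ true → V G x ≡ true
    vertex⁻ x Vx with x ≟ u
    ... | no _ = Vx
    removed : V (G ∖ u) u ≡ false
    removed rewrite dec-true (u ≟ u) refl = refl

  deg-∖-neighbour : ∀ {x} → Adj G x u → suc (deg (G ∖ u) x) ≡ deg G x
  deg-∖-neighbour {x} xu = begin
    suc (deg (G ∖ u) x)            ≡⟨ cong suc (length-nbrs (G ∖ u) x) ⟨
    length (u ∷ nbrs (G ∖ u) x)     ≡⟨ unique-⇔-length u∷-unique (nbrs-unique G x) same ⟩
    length (nbrs G x)              ≡⟨ length-nbrs G x ⟩
    deg G x                        ∎
    where
    open ≡-Reasoning
    u∷-unique : Unique (u ∷ nbrs (G ∖ u) x)
    u∷-unique = All.tabulate (λ y∈ u≡y → proj₂ (proj₂ (∖-adj⁻ {x} (to (∈-nbrs (G ∖ u) x) y∈))) (sym u≡y))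
      ∷ nbrs-unique (G ∖ u) x
    same : ∀ {z} → z ∈ u ∷ nbrs (G ∖ u) x ⇔ z ∈ nbrs G x
    same {z} = mk⇔ forth back
      where
      forth : z ∈ u ∷ nbrs (G ∖ u) x → z ∈ nbrs G x
      forth (here refl) = from (∈-nbrs G x) xu
      forth (there z∈)  = from (∈-nbrs G x) (proj₁ (∖-adj⁻ {x} (to (∈-nbrs (G ∖ u) x) z∈)))
      back : z ∈ nbrs G x → z ∈ u ∷ nbrs (G ∖ u) x
      back z∈ with z ≟ u
      ... | yes refl = here refl
      ... | no z≢u   =
        there (from (∈-nbrs (G ∖ u) x) (∖-adj⁺ (to (∈-nbrs G x) z∈) (adj-≢ G xu) z≢u))

  deg-∖-nonNeighbour : ∀ {x} → x ≢ u → ¬ Adj G x u → deg (G ∖ u) x ≡ deg G x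
  deg-∖-nonNeighbour {x} x≢u x≁u = begin
    deg (G ∖ u) x          ≡⟨ length-nbrs (G ∖ u) x ⟨
    length (nbrs (G ∖ u) x) ≡⟨ unique-⇔-length (nbrs-unique (G ∖ u) x) (nbrs-unique G x) same ⟩
    length (nbrs G x)      ≡⟨ length-nbrs G x ⟩
    deg G x                ∎
    where
    open ≡-Reasoning
    same : ∀ {z} → z ∈ nbrs (G ∖ u) x ⇔ z ∈ nbrs G x
    same = mk⇔ (from (∈-nbrs G x) ∘ proj₁ ∘ ∖-adj⁻ ∘ to (∈-nbrs (G ∖ u) x))
      λ z∈ → let xz = to (∈-nbrs G x) z∈ in
        from (∈-nbrs (G ∖ u) x) (∖-adj⁺ xz x≢u λ { refl → x≁u xz })

record FreshAt {n Δ : ℕ} (H : Graph n) (φ : Fin n → Fin n → Fin Δ) (x : Fin n) (a b : Fin Δ)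
  : Set where
  field
    distinct     : a ≢ b
    strong-fresh : ∀ {y} → Adj H x y → φ x y ≢ a
    weak-fresh   : ∀ {y} → Adj H x y → φ y x ≢ b
    complete     : ∀ c → (∃[ y ] Adj H x y × (φ x y ≡ c ⊎ φ y x ≡ c)) ⊎ c ∈₂ (a , b)

module _ {n Δ : ℕ} {H : Graph n} {φ : Fin n → Fin n → Fin Δ} where

  open Admissibility (_≟_ {Δ})

  missingPairs : IsCondIncColoring Δ H φ → ∀ x → deg H x + 2 ≡ Δ →
    ∃₂ λ S W → MissingPair (Adj H x) (φ x) S × MissingPair (Adj H x) (λ y → φ y x) W
  missingPairs (_ , weak-distinct , strong-distinct , _) x deg+2≡Δ =
    let (S , missingS) = missingPair (nbrs H x) (nbrs-unique H x) (∈-nbrs H x) (φ x)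
                           (strong-distinct x _ _) length+2≡Δ
        (W , missingW) = missingPair (nbrs H x) (nbrs-unique H x) (∈-nbrs H x) (λ y → φ y x)
                           (weak-distinct x _ _) length+2≡Δ
    in S , W , missingS , missingW
    where
    length+2≡Δ : length (nbrs H x) + 2 ≡ Δ
    length+2≡Δ = trans (cong (_+ 2) (length-nbrs H x)) deg+2≡Δ

  admissible⇒freshAt : ∀ {x S W a b} →
    MissingPair (Adj H x) (φ x) S → MissingPair (Adj H x) (λ y → φ y x) W →
    Admissible S W a b → FreshAt H φ x a b
  admissible⇒freshAt missingS missingW (a∈S , b∈W , a≢b , S∩W⊆ab) = record
    { distinct     = a≢b
    ; strong-fresh = MissingPair.missed missingS a∈S
    ; weak-fresh   = MissingPair.missed missingW b∈W
    ; complete     = complete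
    }
    where
    complete : ∀ c → _
    complete c with MissingPair.hit-or-missed missingS c
    ... | inj₁ (y , xy , e) = inj₁ (y , xy , inj₁ e)
    ... | inj₂ c∈S with MissingPair.hit-or-missed missingW c
    ...   | inj₁ (y , xy , e) = inj₁ (y , xy , inj₂ e)
    ...   | inj₂ c∈W          = inj₂ (S∩W⊆ab c∈S c∈W)

-- α x colours the incidence (x , xu) and β x the incidence (u , xu).
module Extension {n Δ : ℕ} (G : Graph n) (u : Fin n)
  (φ : Fin n → Fin n → Fin Δ) (φ-colouring : IsCondIncColoring Δ (G ∖ u) φ)
  (α β : Fin n → Fin Δ)
  (α-injective : InjectiveOn (Adj G u) α) (β-injective : InjectiveOn (Adj G u) β)
  (fresh : ∀ {x} → Adj G u x → FreshAt (G ∖ u) φ x (α x) (β x))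
  (u-small : deg G u < Δ ∸ 1)
  where

  open VertexDeletion G u
  open FreshAt

  private
    φ-a = proj₁ φ-colouring
    φ-b = proj₁ (proj₂ φ-colouring)
    φ-c = proj₁ (proj₂ (proj₂ φ-colouring))
    φ-d = proj₂ (proj₂ (proj₂ φ-colouring))

  ψ : Fin n → Fin n → Fin Δ
  ψ x y = if does (y ≟ u) then α x else if does (x ≟ u) then β y else φ x y

  ψ-to-u : ∀ x → ψ x u ≡ α x
  ψ-to-u x rewrite dec-true (u ≟ u) refl = refl

  ψ-from-u : ∀ {y} → y ≢ u → ψ u y ≡ β y
  ψ-from-u {y} y≢u rewrite dec-false (y ≟ u) y≢u | dec-true (u ≟ u) refl = refl

  ψ-off-u : ∀ {x y} → x ≢ u → y ≢ u → ψ x y ≡ φ x y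
  ψ-off-u {x} {y} x≢u y≢u rewrite dec-false (y ≟ u) y≢u | dec-false (x ≟ u) x≢u = refl

  ψ-a : ∀ x y → Adj G x y → ψ x y ≢ ψ y x
  ψ-a x y xy with toSum (x ≟ u) | toSum (y ≟ u)
  ... | inj₁ refl | inj₁ refl = ⊥-elim (adj-≢ G xy refl)
  ... | inj₁ refl | inj₂ y≢u rewrite ψ-from-u y≢u | ψ-to-u y = distinct (fresh xy) ∘ sym
  ... | inj₂ x≢u | inj₁ refl rewrite ψ-to-u x | ψ-from-u x≢u = distinct (fresh (adj-sym G xy))
  ... | inj₂ x≢u | inj₂ y≢u rewrite ψ-off-u x≢u y≢u | ψ-off-u y≢u x≢u = φ-a x y (∖-adj⁺ xy x≢u y≢u)

  ψ-b : ∀ x → InjectiveOn (Adj G x) (λ y → ψ y x)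
  ψ-b x with toSum (x ≟ u)
  ... | inj₁ refl = injectiveOn-cong (λ {y} _ → sym (ψ-to-u y)) α-injective
  ... | inj₂ x≢u  = injectiveOn-insert _≟_ u off-u u-fresh
    where
    off-u : InjectiveOn (λ y → Adj G x y × y ≢ u) (λ y → ψ y x)
    off-u = injectiveOn-cong (λ (_ , y≢u) → sym (ψ-off-u y≢u x≢u))
      λ (xy , y≢u) (xz , z≢u) → φ-b x _ _ (∖-adj⁺ xy x≢u y≢u) (∖-adj⁺ xz x≢u z≢u)
    u-fresh : Adj G x u → ∀ {y} → Adj G x y → y ≢ u → ψ u x ≢ ψ y x
    u-fresh xu xy y≢u rewrite ψ-from-u x≢u | ψ-off-u y≢u x≢u =
      weak-fresh (fresh (adj-sym G xu)) (∖-adj⁺ xy x≢u y≢u) ∘ sym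

  ψ-c : ∀ x → InjectiveOn (Adj G x) (ψ x)
  ψ-c x with toSum (x ≟ u)
  ... | inj₁ refl = injectiveOn-cong (λ uy → sym (ψ-from-u (adj-≢ G uy ∘ sym))) β-injective
  ... | inj₂ x≢u  = injectiveOn-insert _≟_ u off-u u-fresh
    where
    off-u : InjectiveOn (λ y → Adj G x y × y ≢ u) (ψ x)
    off-u = injectiveOn-cong (λ (_ , y≢u) → sym (ψ-off-u x≢u y≢u))
      λ (xy , y≢u) (xz , z≢u) → φ-c x _ _ (∖-adj⁺ xy x≢u y≢u) (∖-adj⁺ xz x≢u z≢u)
    u-fresh : Adj G x u → ∀ {y} → Adj G x y → y ≢ u → ψ x u ≢ ψ x y
    u-fresh xu xy y≢u rewrite ψ-to-u x | ψ-off-u x≢u y≢u =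
      strong-fresh (fresh (adj-sym G xu)) (∖-adj⁺ xy x≢u y≢u) ∘ sym

  Appears : Fin n → Fin Δ → Set
  Appears x c = ∃[ y ] Adj G x y × (ψ x y ≡ c ⊎ ψ y x ≡ c)

  appears-off-u : ∀ {x c} → (∃[ y ] Adj (G ∖ u) x y × (φ x y ≡ c ⊎ φ y x ≡ c)) → Appears x c
  appears-off-u (y , xy , e) with ∖-adj⁻ xy
  ... | xy′ , x≢u , y≢u = y , xy′ , Sum.map (trans (ψ-off-u x≢u y≢u)) (trans (ψ-off-u y≢u x≢u)) e

  ψ-d : ∀ x → V G x ≡ true → Δ ∸ 1 ≤ deg G x → ∀ c → Appears x c
  ψ-d x Vx large c with toSum (x ≟ u) | toSum (E G x u ≟ᵇ true)
  ... | inj₁ refl | _       = ⊥-elim (<⇒≱ u-small large)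
  ... | inj₂ x≢u  | inj₁ xu with complete (fresh (adj-sym G xu)) c
  ...   | inj₁ seen        = appears-off-u seen
  ...   | inj₂ (inj₁ refl) = u , xu , inj₁ (ψ-to-u x)
  ...   | inj₂ (inj₂ refl) = u , xu , inj₂ (ψ-from-u x≢u)
  ψ-d x Vx large c | inj₂ x≢u | inj₂ x≁u =
    appears-off-u (φ-d x (∖-vertex⁺ x≢u Vx) (subst (Δ ∸ 1 ≤_) deg-equal large) c)
    where deg-equal = sym (deg-∖-nonNeighbour x≢u x≁u)

  extension : HasCondIncColoring Δ G
  extension = ψ , ψ-a , (λ x _ _ → ψ-b x) , (λ x _ _ → ψ-c x) , ψ-d

module _ {n : ℕ} {A : Set} (v : Fin n) where

  choose : A → A → Fin n → A
  choose a a′ x = if does (x ≟ v) then a else a′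

  choose-here : ∀ {a a′} → choose a a′ v ≡ a
  choose-here rewrite dec-true (v ≟ v) refl = refl

  choose-there : ∀ {a a′ x} → x ≢ v → choose a a′ x ≡ a′
  choose-there {x = x} x≢v rewrite dec-false (x ≟ v) x≢v = refl

  module _ {w : Fin n} {P : Fin n → Set} (v≢w : v ≢ w) (P⊆vw : ∀ {x} → P x → x ≡ v ⊎ x ≡ w) where

    private
      w≢v : w ≢ v
      w≢v = v≢w ∘ sym

    choose-injectiveOn : ∀ {a a′} → a ≢ a′ → InjectiveOn P (choose a a′)
    choose-injectiveOn {a} {a′} a≢a′ Py Pz e with P⊆vw Py | P⊆vw Pz
    ... | inj₁ refl | inj₁ refl = refl
    ... | inj₂ refl | inj₂ refl = refl
    ... | inj₁ refl | inj₂ refl =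
      ⊥-elim (a≢a′ (trans (sym choose-here) (trans e (choose-there w≢v))))
    ... | inj₂ refl | inj₁ refl =
      ⊥-elim (a≢a′ (trans (sym choose-here) (trans (sym e) (choose-there w≢v))))

    choose-on : {Q : Fin n → A → A → Set} {a a′ b b′ : A} → Q v a b → Q w a′ b′ →
      ∀ {x} → P x → Q x (choose a a′ x) (choose b b′ x)
    choose-on {Q} Qv Qw Px with P⊆vw Px
    ... | inj₁ refl = subst₂ (Q v) (sym choose-here) (sym choose-here) Qv
    ... | inj₂ refl = subst₂ (Q w) (sym (choose-there w≢v)) (sym (choose-there w≢v)) Qw

degree-two-reducible : ∀ {n Δ} {G : Graph n} {u v w : Fin n} → 4 ≤ Δ → deg G u ≡ 2 →
  Adj G u v → Adj G u w → v ≢ w → (∀ x → Adj G u x → x ≡ v ⊎ x ≡ w) →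
  deg G v ≡ Δ ∸ 1 → deg G w ≡ Δ ∸ 1 →
  HasCondIncColoring Δ (G ∖ u) → HasCondIncColoring Δ G
degree-two-reducible {Δ = Δ} {G} {u} {v} {w} (s≤s (s≤s (s≤s (s≤s _))))
  deg-u uv uw v≢w N⊆vw deg-v deg-w (φ , φ-colouring) =
  let (_ , _ , missingSv , missingWv) = missingPairs {H = G ∖ u} φ-colouring v (deg-∖+2 uv deg-v)
      (_ , _ , missingSw , missingWw) = missingPairs {H = G ∖ u} φ-colouring w (deg-∖+2 uw deg-w)
      (a , b , a′ , b′ , ab , a′b′ , a≢a′ , b≢b′) = compatible
        (distinct missingSv) (distinct missingWv) (distinct missingSw) (distinct missingWw)
  in Extension.extension G u φ φ-colouring (choose v a a′) (choose v b b′)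
       (choose-injectiveOn v v≢w (N⊆vw _) a≢a′) (choose-injectiveOn v v≢w (N⊆vw _) b≢b′)
       (choose-on v v≢w (N⊆vw _) {Q = FreshAt (G ∖ u) φ} (admissible⇒freshAt missingSv missingWv ab)
                                 (admissible⇒freshAt missingSw missingWw a′b′))
       (subst (_< Δ ∸ 1) (sym deg-u) (s≤s (s≤s (s≤s z≤n))))
  where
  open Admissibility (_≟_ {Δ})
  open VertexDeletion G u
  open MissingPair using (distinct)
  deg-∖+2 : ∀ {x} → Adj G u x → deg G x ≡ Δ ∸ 1 → deg (G ∖ u) x + 2 ≡ Δ
  deg-∖+2 ux deg-x = trans (+-comm _ 2) (cong suc (trans (deg-∖-neighbour (adj-sym G ux)) deg-x))

lemma13 : (Δ : ℕ) → 4 ≤ Δ → (n : ℕ) → (G : Graph n) → RhoCritical Δ G →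
    ¬ (∃[ u ] ∃[ v ] ∃[ w ]
    (V G u ≡ true × deg G u ≡ 2
    × Adj G u v × Adj G u w × v ≢ w
    × (∀ x → Adj G u x → x ≡ v ⊎ x ≡ w)
    × deg G v ≡ Δ ∸ 1 × deg G w ≡ Δ ∸ 1))
lemma13 Δ 4≤Δ n G (_ , uncolourable , minimal)
  (u , v , w , Vu , deg-u , uv , uw , v≢w , N⊆vw , deg-v , deg-w) =
  uncolourable (degree-two-reducible {G = G} 4≤Δ deg-u uv uw v≢w N⊆vw deg-v deg-w
    (minimal (G ∖ u) (VertexDeletion.∖-proper G u Vu)))
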